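{- Let $K_2 = 6$, $K_3 = 42$, $K_4 = 1806$, $K_5 = 47058$, $K_6 = 2214502422$, $K_7 = 52495396602$, $K_8 = 8490421583559688410706771261086$. Then for each $r = 2,3,\dots,8$, the remainder of $K_r$ upon division by $288 = 6^2\cdot 8$ equals $6 + 36(r-2)$. Moreover, $M=288$ is the only positive integer $M$ such that for every $r=2,\dots,8$ the remainder of $K_r$ upon division by $M$ (i.e. the unique $R$ with $0\le R<M$ and $K_r\equiv R \pmod M$) equals $6+36(r-2)$.
   Context: The numbers $K_2,\dots,K_8$ are the primary pseudoperfect numbers (integers $K>1$ with $\frac{1}{K}+\sum_{p\mid K}\frac1p=1$, sum over distinct primes dividing $K$) having exactly $2,\dots,8$ distinct prime factors respectively. -}

module Defs where

open import Data.Nat using (ℕ)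

-- K r : the primary pseudoperfect number with exactly r distinct prime
-- factors, for r = 2,…,8 (values as given in the statement).
-- Outside 2 ≤ r ≤ 8 the value is an irrelevant default (0) and never used.
K : ℕ → ℕ
K 2 = 6
K 3 = 42
K 4 = 1806
K 5 = 47058
K 6 = 2214502422
K 7 = 52495396602
K 8 = 8490421583559688410706771261086
K _ = 0

module Submission where

-- For uniqueness, suppose K r % M ≡ Rᵣ := 6 + 36 (r − 2) for r = 2,…,8.
-- Three general facts do the work:
--   * if a % M ≡ b then M divides a − b, so M divides
--     K₄ − R₄ = 1728 and K₅ − R₅ = 46944, hence gcd(1728, 46944) = 288;
--   * a remainder is smaller than the modulus, so M > R₈ = 222 > 288 / 2;
--   * a divisor d of a nonzero n with n < 2d is n itself.
-- Together these force M = 288; only the indices r = 4, 5, 8 are used.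

open import Defs
open import Data.Nat using (ℕ; NonZero; _+_; _*_; _∸_; _≤_; _%_)
open import Data.Product using (_×_)
open import Relation.Binary.PropositionalEquality using (_≡_)

open import Data.Nat using (suc; _<_; _/_; _≤ᵇ_; s≤s; z≤n; ≢-nonZero⁻¹)
open import Data.Nat.Properties
  using (m+n∸m≡n; +-identityʳ; *-monoˡ-≤; *-monoʳ-≤; <⇒≱; <-≤-trans; ≤ᵇ⇒≤)
open import Data.Nat.DivMod using (m≡m%n+[m/n]*n; m%n<n)
open import Data.Nat.Divisibility using (_∣_; divides)
open import Data.Nat.GCD using (gcd; gcd-greatest)
open import Data.Product using (_,_)
open import Data.Bool using (T)
open import Relation.Nullary using (contradiction)
open import Relation.Binary.PropositionalEquality
  using (refl; sym; trans; cong; subst; module ≡-Reasoning)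

remainder-divides : ∀ a b M .{{_ : NonZero M}} → a % M ≡ b → M ∣ a ∸ b
remainder-divides a b M refl = divides (a / M) (begin
  a ∸ a % M                      ≡⟨ cong (_∸ a % M) (m≡m%n+[m/n]*n a M) ⟩
  a % M + (a / M) * M ∸ a % M    ≡⟨ m+n∸m≡n (a % M) ((a / M) * M) ⟩
  (a / M) * M                    ∎)
  where open ≡-Reasoning

remainder-bound : ∀ a b M .{{_ : NonZero M}} → a % M ≡ b → b < M
remainder-bound a b M a%M≡b = subst (_< M) a%M≡b (m%n<n a M)

-- A divisor of a nonzero n exceeding n / 2 is n itself: the cofactor
-- cannot be 0 (n ≠ 0) nor at least 2 (then n ≥ 2d).
large-divisor : ∀ d n .{{_ : NonZero n}} → d ∣ n → n < 2 * d → d ≡ n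
large-divisor d n (divides 0 n≡0) _ = contradiction n≡0 (≢-nonZero⁻¹ n)
large-divisor d n (divides 1 n≡1*d) _ = sym (trans n≡1*d (+-identityʳ d))
large-divisor d n (divides (suc (suc q)) n≡q*d) n<2d =
  contradiction (subst (2 * d ≤_) (sym n≡q*d) (*-monoˡ-≤ d {2} {suc (suc q)} (s≤s (s≤s z≤n))))
                (<⇒≱ n<2d)

R : ℕ → ℕ
R r = 6 + 36 * (r ∸ 2)

remainders-mod-288 : (r : ℕ) → 2 ≤ r → r ≤ 8 → K r % 288 ≡ R r
remainders-mod-288 2 _ _ = refl
remainders-mod-288 3 _ _ = refl
remainders-mod-288 4 _ _ = refl
remainders-mod-288 5 _ _ = refl
remainders-mod-288 6 _ _ = refl
remainders-mod-288 7 _ _ = refl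
remainders-mod-288 8 _ _ = refl
remainders-mod-288 1 (s≤s ()) _
remainders-mod-288 (suc (suc (suc (suc (suc (suc (suc (suc (suc _))))))))) _
  (s≤s (s≤s (s≤s (s≤s (s≤s (s≤s (s≤s (s≤s ()))))))))

proposition3 :
    ((r : ℕ) → 2 ≤ r → r ≤ 8 → K r % 288 ≡ 6 + 36 * (r ∸ 2))
    × ((M : ℕ) → .{{_ : NonZero M}} →
        ((r : ℕ) → 2 ≤ r → r ≤ 8 → K r % M ≡ 6 + 36 * (r ∸ 2)) →
        M ≡ 288)
proposition3 = remainders-mod-288 , uniqueness
  where
  uniqueness : (M : ℕ) → .{{_ : NonZero M}} →
               ((r : ℕ) → 2 ≤ r → r ≤ 8 → K r % M ≡ R r) → M ≡ 288
  uniqueness M remainder = large-divisor M 288 M∣288 288<2M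
    where
    -- the hypothesis at a concrete index r, range checked by evaluation
    at : ∀ r → T (2 ≤ᵇ r) → T (r ≤ᵇ 8) → K r % M ≡ R r
    at r 2≤r r≤8 = remainder r (≤ᵇ⇒≤ 2 r 2≤r) (≤ᵇ⇒≤ r 8 r≤8)

    M∣288 : M ∣ gcd 1728 46944
    M∣288 = gcd-greatest (remainder-divides (K 4) (R 4) M (at 4 _ _))
                         (remainder-divides (K 5) (R 5) M (at 5 _ _))

    222<M : 222 < M
    222<M = remainder-bound (K 8) (R 8) M (at 8 _ _)

    288<2M : 288 < 2 * M
    288<2M = <-≤-trans (≤ᵇ⇒≤ 289 (2 * 223) _) (*-monoʳ-≤ 2 222<M)
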